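{- Let $\Gamma$ be a commutative quasi-thin weakly distance-regular digraph of valency more than $3$. Suppose $\tilde d,\tilde h,\tilde l\in\tilde\partial(\Gamma)$ and $k_{\tilde d}=2$. Then: (i) $k_{\tilde h}=k_{\tilde h^*}\leq2$; (ii) $|\Gamma_{\tilde h}\Gamma_{\tilde l}|\leq2$, with equality only if $k_{\tilde h}=k_{\tilde l}=2$; (iii) $p^{\tilde e}_{\tilde d,\tilde d}=2$ for some $\tilde e\in\tilde\partial(\Gamma)$; (iv) $\Gamma_{\tilde d}\Gamma_{\tilde d^*}=\{\Gamma_{0,0},\Gamma_{e,e}\}$ for some integer $e$; in particular, if $p^{\tilde e}_{\tilde d,\tilde d^*}\neq0$ then $\tilde e=\tilde e^*$.
   Context: All digraphs are finite and simple. $\partial(x,y)$ is the length of a shortest directed path from $x$ to $y$, $\tilde\partial(x,y)=(\partial(x,y),\partial(y,x))$, $\tilde\partial(\Gamma)=\{\tilde\partial(x,y)\}$; for $\tilde i=(a,b)$, $\tilde i^*=(b,a)$. A strongly connected digraph is weakly distance-regular if for all $\tilde h,\tilde i,\tilde j\in\tilde\partial(\Gamma)$ the number $p^{\tilde h}_{\tilde i,\tilde j}=|\{z\mid\tilde\partial(x,z)=\tilde i,\tilde\partial(z,y)=\tilde j\}|$ depends only on $\tilde h=\tilde\partial(x,y)$; $k_{\tilde i}=|\{y\mid\tilde\partial(x,y)=\tilde i\}|$; valency $=\sum_{(1,j)\in\tilde\partial(\Gamma)}k_{(1,j)}$. Commutative: $p^{\tilde h}_{\tilde i,\tilde j}=p^{\tilde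 h}_{\tilde j,\tilde i}$; quasi-thin: maximum intersection number is $2$. $\Gamma_{\tilde i}=\{(x,y)\mid\tilde\partial(x,y)=\tilde i\}$ (written $\Gamma_{a,b}$ for $\tilde i=(a,b)$), $R=\{\Gamma_{\tilde i}\}$, and for $\Gamma_{\tilde i},\Gamma_{\tilde j}\in R$, $\Gamma_{\tilde i}\Gamma_{\tilde j}=\{\Gamma_{\tilde h}\mid p^{\tilde h}_{\tilde i,\tilde j}\neq0\}$. -}

module Defs where

open import Data.Nat using (ℕ; zero; suc; _+_; _≡ᵇ_)
open import Data.Bool using (Bool; true; false; if_then_else_; _∧_; _∨_)
open import Data.Fin using (Fin; zero; suc; _≟_)
open import Data.Product using (_×_; _,_; proj₁; proj₂; Σ; ∃)
open import Relation.Nullary.Decidable using (⌊_⌋)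
open import Relation.Binary.PropositionalEquality using (_≡_; _≢_)

record Digraph : Set where
  field
    n      : ℕ
    adj    : Fin n → Fin n → Bool
    irrefl : ∀ x → adj x x ≡ false

count : ∀ {n} → (Fin n → Bool) → ℕ
count {zero}  P = 0
count {suc n} P = (if P zero then 1 else 0) + count (λ i → P (suc i))

anyF : ∀ {n} → (Fin n → Bool) → Bool
anyF {zero}  P = false
anyF {suc n} P = P zero ∨ anyF (λ i → P (suc i))

Pair : Set
Pair = ℕ × ℕ

_==ᵖ_ : Pair → Pair → Bool
(a , b) ==ᵖ (c , d) = (a ≡ᵇ c) ∧ (b ≡ᵇ d)

_* : Pair → Pair
(a , b) * = (b , a)

module _ (Γ : Digraph) where
  open Digraph Γ

  V : Set
  V = Fin n

  reach : ℕ → V → V → Bool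
  reach zero    x y = ⌊ x ≟ y ⌋
  reach (suc m) x y = anyF (λ z → adj x z ∧ reach m z y)

  StronglyConnected : Set
  StronglyConnected = ∀ (x y : V) → ∃ λ m → reach m x y ≡ true

  searchDist : ℕ → ℕ → V → V → ℕ
  searchDist zero       start x y = start
  searchDist (suc fuel) start x y =
    if reach start x y then start else searchDist fuel (suc start) x y

  -- In a strongly connected digraph on n vertices it is < n, so searching
  -- m = 0,…,n-1 finds it (value n is returned only if y is unreachable).
  ∂ : V → V → ℕ
  ∂ x y = searchDist n 0 x y

  ∂̃ : V → V → Pair
  ∂̃ x y = (∂ x y , ∂ y x)

  InD : Pair → Set
  InD i = ∃ λ (x : V) → ∃ λ (y : V) → ∂̃ x y ≡ i

  -- p^{∂̃(x,y)}_{ĩ,j̃} computed at the pair (x,y)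
  p : V → V → Pair → Pair → ℕ
  p x y i j = count (λ z → (∂̃ x z ==ᵖ i) ∧ (∂̃ z y ==ᵖ j))

  -- k_ĩ computed at the vertex x
  k : V → Pair → ℕ
  k x i = count (λ y → ∂̃ x y ==ᵖ i)

  -- valency at x: Σ_{(1,j)} k_{(1,j)} = #{ y | ∂(x,y) = 1 }
  valency : V → ℕ
  valency x = count (λ y → ∂ x y ≡ᵇ 1)

  WeaklyDistanceRegular : Set
  WeaklyDistanceRegular =
    StronglyConnected ×
    (∀ (x y x′ y′ : V) → ∂̃ x y ≡ ∂̃ x′ y′ → ∀ i j → p x y i j ≡ p x′ y′ i j)

  Commutative : Set
  Commutative = ∀ (x y : V) i j → p x y i j ≡ p x y j i

  QuasiThin : Set
  QuasiThin = (∀ (x y : V) i j → p x y i j Data.Nat.≤ 2) ×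
              (∃ λ (x : V) → ∃ λ (y : V) → ∃ λ i → ∃ λ j → p x y i j ≡ 2)

  -- Γ_g̃ ∈ Γ_h̃ Γ_l̃ , i.e. g̃ ∈ ∂̃(Γ) and p^g̃_{h̃,l̃} ≠ 0
  InProd : Pair → Pair → Pair → Set
  InProd h l g = ∃ λ (x : V) → ∃ λ (y : V) → (∂̃ x y ≡ g) × (p x y h l ≢ 0)

-- Quasi-thinness bounds k_ĩ = p^{(0,0)}_{ĩ,ĩ*} by 2, and commutativity of this intersection
-- number gives k_ĩ = k_{ĩ*}.  Fixing x, z with ∂̃(x,z) = h̃, weak distance-regularity realises
-- every Γ_g̃ ∈ Γ_h̃ Γ_l̃ as g̃ = ∂̃(x,u) with ∂̃(z,u) = l̃; distinct g̃ need distinct u, and there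
-- are only k_l̃ ≤ 2 of those.  For h̃ = d̃, l̃ = d̃* one such u is x itself, giving (0,0), and
-- the other gives a single further class Γ_g̃; since Γ_d̃ Γ_d̃* is closed under transposition,
-- g̃* ∈ {(0,0), g̃}, so g̃ = (e,e).  For (iii), the two vertices of Γ_d̃(x) are joined by a walk of
-- type (d̃*, d̃) through x, which commutativity turns into one of type (d̃, d̃*) through some w;
-- then both lie on (d̃, d̃)-walks from x to w.

module Submission where

open import Defs
open import Data.Bool using (Bool; true; false; T; not; _∧_; if_then_else_)
open import Data.Bool.Properties using (T-∧; T-not-≡; ∧-comm; ∧-idem; ∧-identityʳ)
open import Data.Fin using (Fin; zero; suc)
open import Data.Fin.Properties using (_≟_)
open import Data.Nat using (ℕ; zero; suc; _+_; _≤_; _<_; z≤n; s≤s; _≡ᵇ_)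
open import Data.Nat.Properties using (≡ᵇ⇒≡; ≡⇒≡ᵇ; +-suc; suc-injective; ≤-antisym; ≤-trans)
open import Data.Product using (_×_; _,_; ∃; proj₁; proj₂)
open import Data.Sum using (_⊎_; inj₁; inj₂)
open import Function using (_∘_)
open import Function.Bundles using (_⇔_; mk⇔; module Equivalence)
open import Relation.Binary.PropositionalEquality
  using (_≡_; _≢_; refl; sym; trans; cong; cong₂; subst; module ≡-Reasoning)
open import Relation.Nullary using (yes; no; does; contradiction)
open import Relation.Nullary.Decidable using (dec-true; dec-false)

open Equivalence using (to; from)

*-involutive : ∀ g → (g *) * ≡ g
*-involutive (a , b) = refl

*-fixed-or-0⇒diagonal : ∀ g → g * ≡ (0 , 0) ⊎ g * ≡ g → g ≡ (proj₁ g , proj₁ g)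
*-fixed-or-0⇒diagonal (a , b) (inj₁ refl) = refl
*-fixed-or-0⇒diagonal (a , b) (inj₂ refl) = refl

==ᵖ⇒≡ : ∀ g h → T (g ==ᵖ h) → g ≡ h
==ᵖ⇒≡ (a , b) (c , d) t =
  let ta , tb = to T-∧ t in cong₂ _,_ (≡ᵇ⇒≡ a c ta) (≡ᵇ⇒≡ b d tb)

≡⇒==ᵖ : ∀ {g h} → g ≡ h → T (g ==ᵖ h)
≡⇒==ᵖ {a , b} refl = from T-∧ (≡⇒≡ᵇ a a refl , ≡⇒≡ᵇ b b refl)

==ᵖ-* : ∀ g h → ((g *) ==ᵖ (h *)) ≡ (g ==ᵖ h)
==ᵖ-* (a , b) (c , d) = ∧-comm (b ≡ᵇ d) (a ≡ᵇ c)

count-cong : ∀ {n} {P Q : Fin n → Bool} → (∀ i → P i ≡ Q i) → count P ≡ count Q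
count-cong {zero}  _   = refl
count-cong {suc n} P≗Q =
  cong₂ _+_ (cong (λ b → if b then 1 else 0) (P≗Q zero)) (count-cong (λ i → P≗Q (suc i)))

_∖_ : ∀ {n} → (Fin n → Bool) → Fin n → Fin n → Bool
(P ∖ a) i = P i ∧ not (does (i ≟ a))

count-remove : ∀ {n} (P : Fin n → Bool) {a} → T (P a) → count P ≡ suc (count (P ∖ a))
count-remove {suc n} P {zero} Pa with P zero
... | true = cong suc (count-cong (λ i → sym (∧-identityʳ (P (suc i)))))
count-remove {suc n} P {suc a} Pa
  rewrite ∧-identityʳ (P zero) | count-remove (λ i → P (suc i)) Pa =
  +-suc (if P zero then 1 else 0) (count ((λ i → P (suc i)) ∖ a))

T-∖ : ∀ {n} (P : Fin n → Bool) {a b} → T ((P ∖ a) b) ⇔ (T (P b) × b ≢ a)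
T-∖ P {a} {b} = mk⇔
  (λ t → let Pb , b≉a = to T-∧ t in
         Pb , λ b≡a → contradiction (trans (sym (dec-true (b ≟ a) b≡a)) (to T-not-≡ b≉a)) λ ())
  (λ (Pb , b≢a) → from T-∧ (Pb , from T-not-≡ (dec-false (b ≟ a) b≢a)))

count≢0⇒∃ : ∀ {n} (P : Fin n → Bool) → count P ≢ 0 → ∃ λ a → T (P a)
count≢0⇒∃ {zero}  P c≢0 = contradiction refl c≢0
count≢0⇒∃ {suc n} P c≢0 with P zero in P0
... | true  = zero , subst T (sym P0) _
... | false with count≢0⇒∃ (λ i → P (suc i)) c≢0
...   | a , Pa = suc a , Pa

count≥1 : ∀ {n} (P : Fin n → Bool) {a} → T (P a) → 1 ≤ count P
count≥1 P Pa rewrite count-remove P Pa = s≤s z≤n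

count≢0 : ∀ {n} (P : Fin n → Bool) {a} → T (P a) → count P ≢ 0
count≢0 P Pa c≡0 with subst (1 ≤_) c≡0 (count≥1 P Pa)
... | ()

count≥2 : ∀ {n} (P : Fin n → Bool) {a b} → T (P a) → T (P b) → b ≢ a → 2 ≤ count P
count≥2 P {a} Pa Pb b≢a rewrite count-remove P Pa = s≤s (count≥1 (P ∖ a) (from (T-∖ P) (Pb , b≢a)))

count≥3 : ∀ {n} (P : Fin n → Bool) {a b c} → T (P a) → T (P b) → T (P c) →
          b ≢ a → c ≢ a → c ≢ b → 3 ≤ count P
count≥3 P {a} Pa Pb Pc b≢a c≢a c≢b rewrite count-remove P Pa =
  s≤s (count≥2 (P ∖ a) (from (T-∖ P) (Pb , b≢a)) (from (T-∖ P) (Pc , c≢a)) c≢b)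

count≤2⇒pigeonhole : ∀ {n} (P : Fin n → Bool) {a b c} → count P ≤ 2 →
                      T (P a) → T (P b) → T (P c) → a ≡ b ⊎ a ≡ c ⊎ b ≡ c
count≤2⇒pigeonhole P {a} {b} {c} c≤2 Pa Pb Pc with a ≟ b | a ≟ c | b ≟ c
... | yes a≡b | _       | _       = inj₁ a≡b
... | no _    | yes a≡c | _       = inj₂ (inj₁ a≡c)
... | no _    | no _    | yes b≡c = inj₂ (inj₂ b≡c)
... | no a≢b  | no a≢c  | no b≢c
  with ≤-trans (count≥3 P Pa Pb Pc (a≢b ∘ sym) (a≢c ∘ sym) (b≢c ∘ sym)) c≤2
...   | s≤s (s≤s ())

count≡2⇒another : ∀ {n} (P : Fin n → Bool) {a} → count P ≡ 2 → T (P a) →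
                  ∃ λ b → b ≢ a × T (P b)
count≡2⇒another P {a} c≡2 Pa =
  let b , Rb = count≢0⇒∃ (P ∖ a) (λ rest≡0 → contradiction (trans (sym rest≡0) rest≡1) λ ())
      Pb , b≢a = to (T-∖ P) Rb
  in b , b≢a , Pb
  where
  rest≡1 : count (P ∖ a) ≡ 1
  rest≡1 = suc-injective (trans (sym (count-remove P Pa)) c≡2)

module _ (Γ : Digraph) where

  private
    searchDist-refl : ∀ fuel (x : V Γ) → searchDist Γ fuel 0 x x ≡ 0
    searchDist-refl zero       x = refl
    searchDist-refl (suc fuel) x with x ≟ x
    ... | yes _   = refl
    ... | no x≢x = contradiction refl x≢x

  ∂̃-refl : ∀ x → ∂̃ Γ x x ≡ (0 , 0)
  ∂̃-refl x = cong₂ _,_ (searchDist-refl (Digraph.n Γ) x) (searchDist-refl (Digraph.n Γ) x)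

  p≢0⇒∃ : ∀ {x y i j} → p Γ x y i j ≢ 0 → ∃ λ z → ∂̃ Γ x z ≡ i × ∂̃ Γ z y ≡ j
  p≢0⇒∃ {x} {y} {i} {j} p≢0 =
    let z , t = count≢0⇒∃ _ p≢0 ; tx , ty = to T-∧ t in
    z , ==ᵖ⇒≡ (∂̃ Γ x z) i tx , ==ᵖ⇒≡ (∂̃ Γ z y) j ty

  ∃⇒p≢0 : ∀ {x y z i j} → ∂̃ Γ x z ≡ i → ∂̃ Γ z y ≡ j → p Γ x y i j ≢ 0
  ∃⇒p≢0 {x} {y} {z} {i} {j} xz zy =
    count≢0 (λ w → (∂̃ Γ x w ==ᵖ i) ∧ (∂̃ Γ w y ==ᵖ j)) (from T-∧ (≡⇒==ᵖ xz , ≡⇒==ᵖ zy))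

  k≡p : ∀ x i → k Γ x i ≡ p Γ x x i (i *)
  k≡p x i = count-cong λ z → begin
    ∂̃ Γ x z ==ᵖ i                                ≡⟨ ∧-idem _ ⟨
    (∂̃ Γ x z ==ᵖ i) ∧ (∂̃ Γ x z ==ᵖ i)             ≡⟨ cong ((∂̃ Γ x z ==ᵖ i) ∧_) (==ᵖ-* (∂̃ Γ x z) i) ⟨
    (∂̃ Γ x z ==ᵖ i) ∧ (∂̃ Γ z x ==ᵖ (i *))         ∎
    where open ≡-Reasoning

  InProd⇒pair : ∀ {h l g} → InProd Γ h l g → ∃ λ x → ∃ λ z → ∂̃ Γ x z ≡ h
  InProd⇒pair (x , _ , _ , p≢0) = let z , xz , _ = p≢0⇒∃ p≢0 in x , z , xz

  InProd-* : ∀ {h l g} → InProd Γ h l g → InProd Γ (l *) (h *) (g *)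
  InProd-* (x , y , xy , p≢0) =
    let z , xz , zy = p≢0⇒∃ p≢0 in
    y , x , cong _* xy , ∃⇒p≢0 (cong _* zy) (cong _* xz)

  InProd-refl : ∀ {x z h} → ∂̃ Γ x z ≡ h → InProd Γ h (h *) (0 , 0)
  InProd-refl {x} xz = x , x , ∂̃-refl x , ∃⇒p≢0 xz (cong _* xz)

  k≢0⇒∃ : ∀ {x i} → k Γ x i ≢ 0 → ∃ λ z → ∂̃ Γ x z ≡ i
  k≢0⇒∃ {x} {i} k≢0 = let z , t = count≢0⇒∃ _ k≢0 in z , ==ᵖ⇒≡ (∂̃ Γ x z) i t

  k≡2⇒another : ∀ {x z i} → k Γ x i ≡ 2 → ∂̃ Γ x z ≡ i → ∃ λ z′ → z′ ≢ z × ∂̃ Γ x z′ ≡ i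
  k≡2⇒another {x} {z} {i} k≡2 xz =
    let z′ , z′≢z , t = count≡2⇒another _ k≡2 (≡⇒==ᵖ xz) in z′ , z′≢z , ==ᵖ⇒≡ (∂̃ Γ x z′) i t

  k≥2 : ∀ {x u u′ i} → ∂̃ Γ x u ≡ i → ∂̃ Γ x u′ ≡ i → u′ ≢ u → 2 ≤ k Γ x i
  k≥2 xu xu′ = count≥2 _ (≡⇒==ᵖ xu) (≡⇒==ᵖ xu′)

  k≤2 : QuasiThin Γ → ∀ x i → k Γ x i ≤ 2
  k≤2 (p≤2 , _) x i = subst (_≤ 2) (sym (k≡p x i)) (p≤2 x x i (i *))

  k-pigeonhole : QuasiThin Γ → ∀ {x u₁ u₂ u₃ i} →
                 ∂̃ Γ x u₁ ≡ i → ∂̃ Γ x u₂ ≡ i → ∂̃ Γ x u₃ ≡ i → u₁ ≡ u₂ ⊎ u₁ ≡ u₃ ⊎ u₂ ≡ u₃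
  k-pigeonhole qt {x} {i = i} xu₁ xu₂ xu₃ =
    count≤2⇒pigeonhole _ (k≤2 qt x i) (≡⇒==ᵖ xu₁) (≡⇒==ᵖ xu₂) (≡⇒==ᵖ xu₃)

  module _ (comm : Commutative Γ) where

    InProd-comm : ∀ {h l g} → InProd Γ h l g → InProd Γ l h g
    InProd-comm {h} {l} (x , y , xy , p≢0) = x , y , xy , p≢0 ∘ trans (comm x y h l)

    k-* : ∀ x h → k Γ x h ≡ k Γ x (h *)
    k-* x (a , b) = begin
      k Γ x (a , b)               ≡⟨ k≡p x (a , b) ⟩
      p Γ x x (a , b) (b , a)     ≡⟨ comm x x (a , b) (b , a) ⟩
      p Γ x x (b , a) (a , b)     ≡⟨ k≡p x (b , a) ⟨
      k Γ x (b , a)               ∎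
      where open ≡-Reasoning

    ∃p-dd≡2 : QuasiThin Γ → ∀ {x₀ d} → k Γ x₀ d ≡ 2 → ∃ λ x → ∃ λ y → p Γ x y d d ≡ 2
    ∃p-dd≡2 (p≤2 , _) {x₀} {d} k≡2
      with z₁ , x₀z₁ ← k≢0⇒∃ {x₀} (λ k≡0 → contradiction (trans (sym k≡0) k≡2) λ ())
      with z₂ , z₂≢z₁ , x₀z₂ ← k≡2⇒another k≡2 x₀z₁
      with w , z₁w , wz₂ ← p≢0⇒∃ (∃⇒p≢0 (cong _* x₀z₁) x₀z₂ ∘ trans (comm z₁ z₂ (d *) d))
      = x₀ , w , ≤-antisym (p≤2 x₀ w d d) (count≥2 _ (path x₀z₁ z₁w) (path x₀z₂ z₂w) z₂≢z₁)
      where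
      path : ∀ {z} → ∂̃ Γ x₀ z ≡ d → ∂̃ Γ z w ≡ d → T ((∂̃ Γ x₀ z ==ᵖ d) ∧ (∂̃ Γ z w ==ᵖ d))
      path x₀z zw = from T-∧ (≡⇒==ᵖ x₀z , ≡⇒==ᵖ zw)
      z₂w : ∂̃ Γ z₂ w ≡ d
      z₂w = trans (cong _* wz₂) (*-involutive d)

  module _ (wdr : WeaklyDistanceRegular Γ) where

    p-transfer : ∀ {x₀ y₀ x y i j} → ∂̃ Γ x y ≡ ∂̃ Γ x₀ y₀ → p Γ x₀ y₀ i j ≢ 0 →
                 ∃ λ z → ∂̃ Γ x z ≡ i × ∂̃ Γ z y ≡ j
    p-transfer {x₀} {y₀} {x} {y} {i} {j} xy p≢0 =
      p≢0⇒∃ (p≢0 ∘ trans (proj₂ wdr x₀ y₀ x y (sym xy) i j))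

    k-const : ∀ x x′ i → k Γ x i ≡ k Γ x′ i
    k-const x x′ i = begin
      k Γ x i             ≡⟨ k≡p x i ⟩
      p Γ x x i (i *)     ≡⟨ proj₂ wdr x x x′ x′ (trans (∂̃-refl x) (sym (∂̃-refl x′))) i (i *) ⟩
      p Γ x′ x′ i (i *)   ≡⟨ k≡p x′ i ⟨
      k Γ x′ i            ∎
      where open ≡-Reasoning

    InProd-realise : ∀ {x z h l g} → ∂̃ Γ x z ≡ h → InProd Γ h l g →
                     ∃ λ u → ∂̃ Γ z u ≡ l × ∂̃ Γ x u ≡ g
    InProd-realise {x} {z} {h} {l} xz (x′ , y′ , x′y′ , p≢0)
      with w , x′w , wy′ ← p≢0⇒∃ p≢0
      with u , xu , uz ← p-transfer (trans xz (sym x′w)) (∃⇒p≢0 x′y′ (cong _* wy′))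
      = u , trans (cong _* uz) (*-involutive l) , xu

    module _ (qt : QuasiThin Γ) where

      InProd-pigeonhole : ∀ {h l g₁ g₂ g₃} → InProd Γ h l g₁ → InProd Γ h l g₂ → InProd Γ h l g₃ →
                          g₁ ≡ g₂ ⊎ g₁ ≡ g₃ ⊎ g₂ ≡ g₃
      InProd-pigeonhole g₁∈ g₂∈ g₃∈
        with x , z , xz ← InProd⇒pair g₁∈
        with u₁ , zu₁ , xu₁ ← InProd-realise xz g₁∈
        with u₂ , zu₂ , xu₂ ← InProd-realise xz g₂∈
        with u₃ , zu₃ , xu₃ ← InProd-realise xz g₃∈
        with k-pigeonhole qt zu₁ zu₂ zu₃
      ... | inj₁ refl        = inj₁ (trans (sym xu₁) xu₂)
      ... | inj₂ (inj₁ refl) = inj₂ (inj₁ (trans (sym xu₁) xu₃))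
      ... | inj₂ (inj₂ refl) = inj₂ (inj₂ (trans (sym xu₂) xu₃))

      InProd-distinct⇒kʳ≡2 : ∀ {h l g₁ g₂} → InProd Γ h l g₁ → InProd Γ h l g₂ → g₁ ≢ g₂ →
                             ∀ x → k Γ x l ≡ 2
      InProd-distinct⇒kʳ≡2 {l = l} g₁∈ g₂∈ g₁≢g₂ x
        with x₀ , z , x₀z ← InProd⇒pair g₁∈
        with u₁ , zu₁ , x₀u₁ ← InProd-realise x₀z g₁∈
        with u₂ , zu₂ , x₀u₂ ← InProd-realise x₀z g₂∈
        = trans (k-const x z l) (≤-antisym (k≤2 qt z l) (k≥2 zu₁ zu₂ u₂≢u₁))
        where
        u₂≢u₁ : u₂ ≢ u₁
        u₂≢u₁ refl = g₁≢g₂ (trans (sym x₀u₁) x₀u₂)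

      ΓdΓd*-two-classes : Commutative Γ → ∀ {x₀} d → k Γ x₀ d ≡ 2 →
        ∃ λ g → ∀ g′ → InProd Γ d (d *) g′ ⇔ (g′ ≡ (0 , 0) ⊎ g′ ≡ g)
      ΓdΓd*-two-classes comm {x₀} d@(a , b) k≡2
        with z , x₀z ← k≢0⇒∃ {x₀} (λ k≡0 → contradiction (trans (sym k≡0) k≡2) λ ())
        with v , v≢x₀ , zv ← k≡2⇒another (trans (sym (k-* comm z d)) (trans (k-const z x₀ d) k≡2))
                                          (cong _* x₀z)
        = ∂̃ Γ x₀ v , λ g′ → mk⇔ (classify g′) member
        where
        classify : ∀ g′ → InProd Γ d (d *) g′ → g′ ≡ (0 , 0) ⊎ g′ ≡ ∂̃ Γ x₀ v
        classify g′ g′∈ with u , zu , x₀u ← InProd-realise x₀z g′∈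
                        with k-pigeonhole qt zu (cong _* x₀z) zv
        ... | inj₁ refl        = inj₁ (trans (sym x₀u) (∂̃-refl x₀))
        ... | inj₂ (inj₁ refl) = inj₂ (sym x₀u)
        ... | inj₂ (inj₂ x₀≡v) = contradiction (sym x₀≡v) v≢x₀
        member : ∀ {g′} → g′ ≡ (0 , 0) ⊎ g′ ≡ ∂̃ Γ x₀ v → InProd Γ d (d *) g′
        member (inj₁ refl) = InProd-refl x₀z
        member (inj₂ refl) = x₀ , v , refl , ∃⇒p≢0 x₀z zv

      ΓdΓd*-diagonal : Commutative Γ → ∀ {x₀} d → k Γ x₀ d ≡ 2 →
        ∃ λ e → ∀ g → InProd Γ d (d *) g ⇔ (g ≡ (0 , 0) ⊎ g ≡ (e , e))
      ΓdΓd*-diagonal comm d@(a , b) k≡2 =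
        let g , classes = ΓdΓd*-two-classes comm d k≡2
            g*-class = to (classes (g *)) (InProd-* (from (classes g) (inj₂ refl)))
        in proj₁ g , λ g′ → subst (λ g₀ → InProd Γ d (d *) g′ ⇔ (g′ ≡ (0 , 0) ⊎ g′ ≡ g₀))
                                  (*-fixed-or-0⇒diagonal g g*-class) (classes g′)

lemma2p2 : (Γ : Digraph) →
    WeaklyDistanceRegular Γ → Commutative Γ → QuasiThin Γ →
    (∃ λ x → 3 < valency Γ x) →
    (d h l : Pair) → InD Γ d → InD Γ h → InD Γ l →
    (∃ λ x → k Γ x d ≡ 2) →
    (∀ x → (k Γ x h ≡ k Γ x (h *)) × (k Γ x h ≤ 2)) ×
    (∀ g₁ g₂ g₃ → InProd Γ h l g₁ → InProd Γ h l g₂ → InProd Γ h l g₃ →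
       (g₁ ≡ g₂) ⊎ (g₁ ≡ g₃) ⊎ (g₂ ≡ g₃)) ×
    (∀ g₁ g₂ → InProd Γ h l g₁ → InProd Γ h l g₂ → g₁ ≢ g₂ →
       ∀ x → (k Γ x h ≡ 2) × (k Γ x l ≡ 2)) ×
    (∃ λ x → ∃ λ y → p Γ x y d d ≡ 2) ×
    (∃ λ (e : ℕ) → ∀ g → InProd Γ d (d *) g ⇔ ((g ≡ (0 , 0)) ⊎ (g ≡ (e , e)))) ×
    (∀ g → InProd Γ d (d *) g → g ≡ g *)
lemma2p2 Γ wdr comm qt _ d h l _ _ _ (x₀ , k≡2) =
  (λ x → k-* Γ comm x h , k≤2 Γ qt x h) ,
  (λ _ _ _ → InProd-pigeonhole Γ wdr qt) ,
  (λ _ _ g₁∈ g₂∈ g₁≢g₂ x →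
     InProd-distinct⇒kʳ≡2 Γ wdr qt (InProd-comm Γ comm g₁∈) (InProd-comm Γ comm g₂∈) g₁≢g₂ x ,
     InProd-distinct⇒kʳ≡2 Γ wdr qt g₁∈ g₂∈ g₁≢g₂ x) ,
  ∃p-dd≡2 Γ comm qt k≡2 ,
  (e , classes) ,
  λ g → diagonal-symmetric ∘ to (classes g)
  where
  e : ℕ
  e = proj₁ (ΓdΓd*-diagonal Γ wdr qt comm d k≡2)
  classes : ∀ g → InProd Γ d (d *) g ⇔ (g ≡ (0 , 0) ⊎ g ≡ (e , e))
  classes = proj₂ (ΓdΓd*-diagonal Γ wdr qt comm d k≡2)
  diagonal-symmetric : ∀ {g} → g ≡ (0 , 0) ⊎ g ≡ (e , e) → g ≡ g *
  diagonal-symmetric (inj₁ refl) = refl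
  diagonal-symmetric (inj₂ refl) = refl
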